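{- Let $\mathcal{H}$ be a $3$-partite $3$-graph with parts $V_1,V_2,V_3$ (every edge has exactly one vertex in each part), where $|V_1| = |V_3|= t$ and $|V_2| = 2t$, such that for every choice $X_i \subseteq V_i$ ($i=1,2,3$) of size $|X_i| = k$, there exists an edge in $\mathcal{H}[X_1 \cup X_2 \cup X_3]$. Then there is a loose $uv$-path of length $2t - 4k$ in $\mathcal{H}$ with $u,v \in V_1 \cup V_3$, and all of whose other vertices of degree one in the path lie in $V_2$.
   Context: A loose path of length $\ell$ is a sequence of distinct vertices $v_1,\dots,v_{2\ell+1}$ with $v_{2i-1}v_{2i}v_{2i+1}\in E$ for all $i\in[\ell]$; it is a $uv$-path if its endpoints are $v_1=u$ and $v_{2\ell+1}=v$. The degree of a vertex in the path is the number of path edges containing it. -}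

module Defs where

open import Level using (0ℓ)
open import Data.Nat using (ℕ; zero; suc; _+_; _*_; _≤_; _<_; _≡ᵇ_)
open import Data.Bool using (Bool; true; false; _∨_; if_then_else_)
open import Data.Fin using (Fin)
open import Data.Fin.Subset using (Subset; _∈_; ∣_∣)
open import Data.Sum using (_⊎_; inj₁; inj₂)
open import Data.Product using (Σ; ∃; _×_; _,_)
open import Relation.Binary.PropositionalEquality using (_≡_; _≢_)

Vtx : ℕ → Set
Vtx t = Fin t ⊎ (Fin (2 * t) ⊎ Fin t)

v₁ : ∀ {t} → Fin t → Vtx t
v₁ a = inj₁ a

v₂ : ∀ {t} → Fin (2 * t) → Vtx t
v₂ b = inj₂ (inj₁ b)

v₃ : ∀ {t} → Fin t → Vtx t
v₃ c = inj₂ (inj₂ c)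

Tripartite3Graph : ℕ → Set₁
Tripartite3Graph t = Fin t → Fin (2 * t) → Fin t → Set

InV₂ : ∀ {t} → Vtx t → Set
InV₂ {t} v = ∃ λ (b : Fin (2 * t)) → v ≡ v₂ b

InV₁∪V₃ : ∀ {t} → Vtx t → Set
InV₁∪V₃ {t} v = (∃ λ (a : Fin t) → v ≡ v₁ a) ⊎ (∃ λ (c : Fin t) → v ≡ v₃ c)

data Perm3 {A : Set} (p q r : A) : A → A → A → Set where
  σ123 : Perm3 p q r p q r
  σ132 : Perm3 p q r p r q
  σ213 : Perm3 p q r q p r
  σ231 : Perm3 p q r q r p
  σ312 : Perm3 p q r r p q
  σ321 : Perm3 p q r r q p

IsEdge : ∀ {t} → Tripartite3Graph t → Vtx t → Vtx t → Vtx t → Set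
IsEdge {t} E x y z =
  Σ (Fin t) λ a → Σ (Fin (2 * t)) λ b → Σ (Fin t) λ c →
    E a b c × Perm3 (v₁ a) (v₂ b) (v₃ c) x y z

HasEdgeIn : ∀ {t} → Tripartite3Graph t →
            Subset t → Subset (2 * t) → Subset t → Set
HasEdgeIn {t} E X₁ X₂ X₃ =
  Σ (Fin t) λ a → Σ (Fin (2 * t)) λ b → Σ (Fin t) λ c →
    a ∈ X₁ × b ∈ X₂ × c ∈ X₃ × E a b c

-- A loose path of length ℓ: distinct vertices seq 0, …, seq (2ℓ)
-- (0-indexed; paper's v_{j+1} = seq j) with {seq(2i), seq(2i+1), seq(2i+2)} ∈ E for i < ℓ.
record LoosePath {t} (E : Tripartite3Graph t) (ℓ : ℕ) : Set where
  field
    seq      : ℕ → Vtx t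
    distinct : ∀ i j → i ≤ 2 * ℓ → j ≤ 2 * ℓ → seq i ≡ seq j → i ≡ j
    edges    : ∀ i → i < ℓ →
               IsEdge E (seq (2 * i)) (seq (2 * i + 1)) (seq (2 * i + 2))
open LoosePath public

pathDeg : ℕ → ℕ → ℕ
pathDeg zero    j = 0
pathDeg (suc ℓ) j =
  pathDeg ℓ j +
  (if (j ≡ᵇ (2 * ℓ)) ∨ (j ≡ᵇ (2 * ℓ + 1)) ∨ (j ≡ᵇ (2 * ℓ + 2)) then 1 else 0)

GoodPath : ∀ {t} → Tripartite3Graph t → ℕ → Set
GoodPath {t} E ℓ =
  Σ (LoosePath E ℓ) λ P →
    InV₁∪V₃ (seq P 0) × InV₁∪V₃ (seq P (2 * ℓ)) ×
    (∀ j → j ≤ 2 * ℓ → j ≢ 0 → j ≢ 2 * ℓ → pathDeg ℓ j ≡ 1 → InV₂ (seq P j))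

module Submission where

-- Depth-first search for a trail whose vertices alternate between V₁ and V₃, consecutive ones
-- joined by an edge through a vertex of V₂; the interior vertices of degree one of such a path are
-- exactly its V₂-vertices. The end of the trail is extended along an edge into unused vertices
-- whenever one exists; otherwise the end is declared dead and removed. A dead vertex has no edge
-- into the unused vertices of V₂ and of the opposite part, so by the hypothesis a part has fewer
-- than k dead vertices as long as the opposite part still has k unused ones, which counting
-- guarantees while the trail is shorter than 2t − 4k. Every step lowers
-- 2 · #(unused vertices of V₁ ∪ V₃) + #(trail vertices in V₁ ∪ V₃) by one, so the search stops,
-- and it can only stop with a trail of length 2t − 4k.

open import Defs
open import Data.Nat using (ℕ; zero; suc; _+_; _*_; _∸_; _≤_; _<_; _≮_; z≤n; s≤s; z<s; _≟_; _<?_; _≡ᵇ_)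
open import Data.Nat.Properties
open import Data.Nat.Tactic.RingSolver using (solve-∀)
open import Data.Bool using (true; _∨_)
open import Data.Bool.Properties using (∨-zeroʳ)
open import Data.Fin as Fin using (Fin)
import Data.Fin.Properties as Fin
open import Data.Fin.Subset using (Subset; _∈_; _∉_; _⊆_; ∣_∣; _-_; _∪_; ⁅_⁆; inside; outside; Nonempty)
import Data.Fin.Subset as Subset
open import Data.Fin.Subset.Properties
  using (p─⊥≡p; ∪-identityʳ; nonempty?; Empty-unique; ∣⊥∣≡0; ∣⊤∣≡n; ∉⊥; anySubset?; _∈?_;
         p─q⊆p; x∈p∪q⁻; x∈⁅y⁆⇒x≡y; p⊆q⇒∣p∣≤∣q∣)
open import Data.Vec using (_∷_; here; there)
open import Data.Product using (Σ; ∃; _×_; _,_; proj₁; proj₂)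
open import Data.Product.Properties using (≡-dec)
open import Data.Sum using (_⊎_; inj₁; inj₂; [_,_]′)
open import Data.Unit using (⊤; tt)
open import Function using (_∘_)
open import Relation.Nullary using (¬_; Dec; yes; no; contradiction)
open import Relation.Nullary.Decidable using (_×-dec_)
open import Relation.Binary.PropositionalEquality

∣p∣≡1+∣p-x∣ : ∀ {n x} {p : Subset n} → x ∈ p → ∣ p ∣ ≡ suc ∣ p - x ∣
∣p∣≡1+∣p-x∣ {p = _ ∷ p}       here        = cong suc (sym (cong ∣_∣ (p─⊥≡p p)))
∣p∣≡1+∣p-x∣ {p = inside ∷ p}  (there x∈p) = cong suc (∣p∣≡1+∣p-x∣ x∈p)
∣p∣≡1+∣p-x∣ {p = outside ∷ p} (there x∈p) = ∣p∣≡1+∣p-x∣ x∈p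

x∉p-x : ∀ {n} (x : Fin n) (p : Subset n) → x ∉ p - x
x∉p-x Fin.zero    (_ ∷ p) ()
x∉p-x (Fin.suc x) (_ ∷ p) (there x∈p-x) = x∉p-x x p x∈p-x

∣p∪⁅x⁆∣≡1+∣p∣ : ∀ {n x} {p : Subset n} → x ∉ p → ∣ p ∪ ⁅ x ⁆ ∣ ≡ suc ∣ p ∣
∣p∪⁅x⁆∣≡1+∣p∣ {x = Fin.zero}  {inside ∷ p}  x∉p = contradiction here x∉p
∣p∪⁅x⁆∣≡1+∣p∣ {x = Fin.zero}  {outside ∷ p} _   = cong (suc ∘ ∣_∣) (∪-identityʳ p)
∣p∪⁅x⁆∣≡1+∣p∣ {x = Fin.suc x} {inside ∷ p}  x∉p = cong suc (∣p∪⁅x⁆∣≡1+∣p∣ (x∉p ∘ there))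
∣p∪⁅x⁆∣≡1+∣p∣ {x = Fin.suc x} {outside ∷ p} x∉p = ∣p∪⁅x⁆∣≡1+∣p∣ (x∉p ∘ there)

subset-of-size : ∀ {n} k (p : Subset n) → k ≤ ∣ p ∣ → ∃ λ q → q ⊆ p × ∣ q ∣ ≡ k
subset-of-size {n} zero p _ = Subset.⊥ , (λ x∈⊥ → contradiction x∈⊥ ∉⊥) , ∣⊥∣≡0 n
subset-of-size (suc k) (inside ∷ p) (s≤s k≤∣p∣) with subset-of-size k p k≤∣p∣
... | q , q⊆p , ∣q∣≡k = inside ∷ q , (λ { here → here ; (there x∈q) → there (q⊆p x∈q) }) , cong suc ∣q∣≡k
subset-of-size (suc k) (outside ∷ p) k<∣p∣ with subset-of-size (suc k) p k<∣p∣
... | q , q⊆p , ∣q∣≡k = outside ∷ q , (λ { (there x∈q) → there (q⊆p x∈q) }) , ∣q∣≡k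

∣p∣>0⇒nonempty : ∀ {n} (p : Subset n) → 0 < ∣ p ∣ → Nonempty p
∣p∣>0⇒nonempty {n} p 0<∣p∣ with nonempty? p
... | yes ne = ne
... | no ¬ne = contradiction (subst (λ q → 0 < ∣ q ∣) (Empty-unique ¬ne) 0<∣p∣)
                             (subst (0 ≮_) (sym (∣⊥∣≡0 n)) λ ())

2+j≤2[1+n]⇒j≤2n : ∀ {j n} → suc (suc j) ≤ 2 * suc n → j ≤ 2 * n
2+j≤2[1+n]⇒j≤2n {n = n} le rewrite *-suc 2 n = ≤-pred (≤-pred le)

counting-bound : ∀ {T S q m ℓ k} → 2 * (T + S + q) ≡ ℓ + 4 * k → S < k → q + q ≤ m → m ≤ ℓ → k ≤ T
counting-bound {T} {S} {q} {m} {ℓ} {k} count S<k q+q≤m m≤ℓ = ≮⇒≥ λ T<k → n≮n _ (begin-strict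
  2 * (T + S + q)                    <⟨ m<m+n _ z<s ⟩
  2 * (T + S + q) + 4                ≡⟨ regroup T S q ⟩
  2 * suc T + 2 * suc S + (q + q)    ≤⟨ +-mono-≤ (+-mono-≤ (*-monoʳ-≤ 2 T<k) (*-monoʳ-≤ 2 S<k))
                                                  (≤-trans q+q≤m m≤ℓ) ⟩
  2 * k + 2 * k + ℓ                  ≡⟨ regroup′ k ℓ ⟩
  ℓ + 4 * k                          ≡⟨ count ⟨
  2 * (T + S + q)                    ∎)
  where
  open ≤-Reasoning
  regroup : ∀ T S q → 2 * (T + S + q) + 4 ≡ 2 * suc T + 2 * suc S + (q + q)
  regroup = solve-∀
  regroup′ : ∀ k ℓ → 2 * k + 2 * k + ℓ ≡ ℓ + 4 * k
  regroup′ = solve-∀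

m+n+0≡o⇒n<o⇒0<m : ∀ {m n o} → m + n + 0 ≡ o → n < o → 0 < m
m+n+0≡o⇒n<o⇒0<m {zero}  {n} eq n<o = contradiction (trans (sym (+-identityʳ n)) eq) (<⇒≢ n<o)
m+n+0≡o⇒n<o⇒0<m {suc m} _  _       = z<s

Σ-≡? : ∀ {m n : ℕ} {P : m ≡ n → Set} → (∀ e → Dec (P e)) → Dec (Σ (m ≡ n) P)
Σ-≡? {m} {n} {P} P? with m ≟ n
... | no m≢n = no (m≢n ∘ proj₁)
... | yes e with P? e
...   | yes Pe = yes (e , Pe)
...   | no ¬Pe = no λ (e′ , Pe′) → ¬Pe (subst P (≡-irrelevant e′ e) Pe′)

data Side : Set where
  first third : Side

outer : ∀ {t} → Side → Fin t → Vtx t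
outer first = v₁
outer third = v₃

data Opposite : Side → Side → Set where
  first-third : Opposite first third
  third-first : Opposite third first

Opposite-sym : ∀ {s s'} → Opposite s s' → Opposite s' s
Opposite-sym first-third = third-first
Opposite-sym third-first = first-third

opposite-unique : ∀ {s a b} → Opposite s a → Opposite a b → s ≡ b
opposite-unique first-third third-first = refl
opposite-unique third-first first-third = refl

module _ {t : ℕ} where

  outer-injective : ∀ {s} {x y : Fin t} → outer s x ≡ outer s y → x ≡ y
  outer-injective {first} refl = refl
  outer-injective {third} refl = refl

  outer-opposite : ∀ {s s'} {x y : Fin t} → Opposite s s' → outer s x ≢ outer s' y
  outer-opposite first-third ()
  outer-opposite third-first ()

  outer≢v₂ : ∀ {s} {x : Fin t} {c} → outer s x ≢ v₂ c
  outer≢v₂ {first} ()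
  outer≢v₂ {third} ()

  outer∈V₁∪V₃ : ∀ s (x : Fin t) → InV₁∪V₃ (outer s x)
  outer∈V₁∪V₃ first x = inj₁ (x , refl)
  outer∈V₁∪V₃ third x = inj₂ (x , refl)

IsEdge-reverse : ∀ {t} {E : Tripartite3Graph t} {x y z} → IsEdge E x y z → IsEdge E z y x
IsEdge-reverse (a , b , c , e , σ123) = a , b , c , e , σ321
IsEdge-reverse (a , b , c , e , σ132) = a , b , c , e , σ231
IsEdge-reverse (a , b , c , e , σ213) = a , b , c , e , σ312
IsEdge-reverse (a , b , c , e , σ231) = a , b , c , e , σ132
IsEdge-reverse (a , b , c , e , σ312) = a , b , c , e , σ213
IsEdge-reverse (a , b , c , e , σ321) = a , b , c , e , σ123

pathDeg-mono : ∀ d ℓ j → pathDeg ℓ j ≤ pathDeg (d + ℓ) j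
pathDeg-mono zero    ℓ j = ≤-refl
pathDeg-mono (suc d) ℓ j = ≤-trans (pathDeg-mono d ℓ j) (m≤m+n _ _)

≡⇒≡ᵇtrue : ∀ {m n} → m ≡ n → (m ≡ᵇ n) ≡ true
≡⇒≡ᵇtrue {zero}  refl = refl
≡⇒≡ᵇtrue {suc m} refl = ≡⇒≡ᵇtrue {m} refl

pathDeg-suc : ∀ ℓ j → j ≡ 2 * ℓ ⊎ j ≡ 2 * ℓ + 2 → pathDeg (suc ℓ) j ≡ pathDeg ℓ j + 1
pathDeg-suc ℓ j (inj₁ j≡2ℓ) rewrite ≡⇒≡ᵇtrue j≡2ℓ = refl
pathDeg-suc ℓ j (inj₂ j≡2ℓ+2)
  rewrite ≡⇒≡ᵇtrue j≡2ℓ+2 | ∨-zeroʳ (j ≡ᵇ 2 * ℓ + 1) | ∨-zeroʳ (j ≡ᵇ 2 * ℓ) = refl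

-- Position 2(i+1) is the last vertex of edge i and the first vertex of edge i+1.
pathDeg-joint : ∀ i → 2 ≤ pathDeg (suc (suc i)) (2 * suc i)
pathDeg-joint i = begin
  2                                      ≤⟨ m≤n+m 2 (pathDeg i (2 * suc i)) ⟩
  pathDeg i (2 * suc i) + 2              ≡⟨ +-assoc (pathDeg i (2 * suc i)) 1 1 ⟨
  pathDeg i (2 * suc i) + 1 + 1          ≡⟨ cong (_+ 1) (pathDeg-suc i (2 * suc i) (inj₂ 2[1+i]≡2i+2)) ⟨
  pathDeg (suc i) (2 * suc i) + 1        ≡⟨ pathDeg-suc (suc i) (2 * suc i) (inj₁ refl) ⟨
  pathDeg (suc (suc i)) (2 * suc i)      ∎
  where
  open ≤-Reasoning
  2[1+i]≡2i+2 : 2 * suc i ≡ 2 * i + 2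
  2[1+i]≡2i+2 = trans (*-suc 2 i) (+-comm 2 (2 * i))

pathDeg-interior-even : ∀ {ℓ i} → 0 < i → i < ℓ → 2 ≤ pathDeg ℓ (2 * i)
pathDeg-interior-even {ℓ} {suc i} _ i<ℓ = begin
  2                                                ≤⟨ pathDeg-joint i ⟩
  pathDeg (suc (suc i)) (2 * suc i)                ≤⟨ pathDeg-mono (ℓ ∸ suc (suc i)) (suc (suc i)) (2 * suc i) ⟩
  pathDeg (ℓ ∸ suc (suc i) + suc (suc i)) (2 * suc i) ≡⟨ cong (λ n → pathDeg n (2 * suc i)) (m∸n+n≡m i<ℓ) ⟩
  pathDeg ℓ (2 * suc i)                            ∎
  where open ≤-Reasoning

module Trails {t : ℕ} (E : Tripartite3Graph t) where

  -- A trail grows at its end `vertex P 0`; p and q count its vertices in the part of the end and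
  -- in the opposite part.
  data Trail : Side → Fin t → ℕ → ℕ → Set where
    start  : ∀ s x → Trail s x 1 0
    extend : ∀ {s x p q s'} → Trail s x p q → Opposite s s' → (c : Fin (2 * t)) (y : Fin t) →
             IsEdge E (outer s x) (v₂ c) (outer s' y) → Trail s' y (suc q) p

  private variable
    s : Side
    x : Fin t
    p q : ℕ

  length : Trail s x p q → ℕ
  length (start _ _)          = 0
  length (extend P _ _ _ _)   = suc (length P)

  vertex : Trail s x p q → ℕ → Vtx t
  vertex (start s x) _                                  = outer s x
  vertex (extend {s' = s'} _ _ _ y _) zero              = outer s' y
  vertex (extend _ _ c _ _)           (suc zero)        = v₂ c
  vertex (extend P _ _ _ _)           (suc (suc j))     = vertex P j

  AllVertices : (Vtx t → Set) → Trail s x p q → Set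
  AllVertices Q (start s x) = Q (outer s x)
  AllVertices Q (extend {s' = s'} P _ c y _) = AllVertices Q P × Q (v₂ c) × Q (outer s' y)

  Distinct : Trail s x p q → Set
  Distinct (start _ _) = ⊤
  Distinct (extend {s' = s'} P _ c y _) =
    Distinct P × AllVertices (_≢ v₂ c) P × AllVertices (_≢ outer s' y) P

  AllVertices-map : ∀ {Q R : Vtx t → Set} → (∀ {v} → Q v → R v) →
                    (P : Trail s x p q) → AllVertices Q P → AllVertices R P
  AllVertices-map f (start _ _)        Qv              = f Qv
  AllVertices-map f (extend P _ _ _ _) (QP , Qc , Qy)  = AllVertices-map f P QP , f Qc , f Qy

  AllVertices-vertex : ∀ {Q} (P : Trail s x p q) → AllVertices Q P →
                       ∀ j → j ≤ 2 * length P → Q (vertex P j)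
  AllVertices-vertex (start _ _)        Qv            _             _  = Qv
  AllVertices-vertex (extend P _ _ _ _) (_ , _ , Qy)  zero          _  = Qy
  AllVertices-vertex (extend P _ _ _ _) (_ , Qc , _)  (suc zero)    _  = Qc
  AllVertices-vertex (extend P _ _ _ _) (QP , _ , _)  (suc (suc j)) le =
    AllVertices-vertex P QP j (2+j≤2[1+n]⇒j≤2n le)

  vertex-injective : (P : Trail s x p q) → Distinct P → ∀ i j → i ≤ 2 * length P → j ≤ 2 * length P →
                     vertex P i ≡ vertex P j → i ≡ j
  vertex-injective (start _ _) _ zero zero _ _ _ = refl
  vertex-injective (extend P _ _ _ _) _ zero zero _ _ _ = refl
  vertex-injective (extend P _ _ _ _) _ (suc zero) (suc zero) _ _ _ = refl
  vertex-injective (extend {s' = s'} _ _ _ _ _) _ zero (suc zero) _ _ e = contradiction e (outer≢v₂ {s = s'})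
  vertex-injective (extend {s' = s'} _ _ _ _ _) _ (suc zero) zero _ _ e = contradiction (sym e) (outer≢v₂ {s = s'})
  vertex-injective (extend P _ _ _ _) (_ , _ , Py) zero (suc (suc j)) _ lj e =
    contradiction (sym e) (AllVertices-vertex P Py j (2+j≤2[1+n]⇒j≤2n lj))
  vertex-injective (extend P _ _ _ _) (_ , _ , Py) (suc (suc i)) zero li _ e =
    contradiction e (AllVertices-vertex P Py i (2+j≤2[1+n]⇒j≤2n li))
  vertex-injective (extend P _ _ _ _) (_ , Pc , _) (suc zero) (suc (suc j)) _ lj e =
    contradiction (sym e) (AllVertices-vertex P Pc j (2+j≤2[1+n]⇒j≤2n lj))
  vertex-injective (extend P _ _ _ _) (_ , Pc , _) (suc (suc i)) (suc zero) li _ e =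
    contradiction e (AllVertices-vertex P Pc i (2+j≤2[1+n]⇒j≤2n li))
  vertex-injective (extend P _ _ _ _) (dP , _) (suc (suc i)) (suc (suc j)) li lj e =
    cong (suc ∘ suc) (vertex-injective P dP i j (2+j≤2[1+n]⇒j≤2n li) (2+j≤2[1+n]⇒j≤2n lj) e)

  vertex-zero : (P : Trail s x p q) → vertex P 0 ≡ outer s x
  vertex-zero (start _ _)        = refl
  vertex-zero (extend _ _ _ _ _) = refl

  vertex-edge : (P : Trail s x p q) → ∀ i → i < length P →
                IsEdge E (vertex P (2 * i)) (vertex P (2 * i + 1)) (vertex P (2 * i + 2))
  vertex-edge (extend P _ _ _ e) zero    _ =
    subst (IsEdge E _ _) (sym (vertex-zero P)) (IsEdge-reverse e)
  vertex-edge P′@(extend P _ _ _ _) (suc i) i<ℓ =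
    subst (λ n → IsEdge E (vertex P′ n) (vertex P′ (n + 1)) (vertex P′ (n + 2)))
          (sym (*-suc 2 i)) (vertex-edge P i (≤-pred i<ℓ))

  vertex-last : (P : Trail s x p q) → InV₁∪V₃ (vertex P (2 * length P))
  vertex-last (start s x) = outer∈V₁∪V₃ s x
  vertex-last (extend P _ _ _ _) rewrite *-suc 2 (length P) = vertex-last P

  vertex-even-or-V₂ : (P : Trail s x p q) → ∀ j → j ≤ 2 * length P →
                      (∃ λ i → j ≡ 2 * i) ⊎ InV₂ (vertex P j)
  vertex-even-or-V₂ (start _ _)        zero          _  = inj₁ (0 , refl)
  vertex-even-or-V₂ (extend P _ _ _ _) zero          _  = inj₁ (0 , refl)
  vertex-even-or-V₂ (extend P _ c _ _) (suc zero)    _  = inj₂ (c , refl)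
  vertex-even-or-V₂ (extend P _ _ _ _) (suc (suc j)) le with vertex-even-or-V₂ P j (2+j≤2[1+n]⇒j≤2n le)
  ... | inj₁ (i , refl) = inj₁ (suc i , sym (*-suc 2 i))
  ... | inj₂ V₂ = inj₂ V₂

  counts-balanced : Trail s x p q → q ≤ p × p ≤ suc q
  counts-balanced (start _ _)        = z≤n , ≤-refl
  counts-balanced (extend P _ _ _ _) with counts-balanced P
  ... | q≤p , p≤1+q = p≤1+q , s≤s q≤p

  counts-length : (P : Trail s x p q) → p + q ≡ suc (length P)
  counts-length (start _ _) = refl
  counts-length (extend {p = p} {q} P _ _ _ _) = cong suc (trans (+-comm q p) (counts-length P))

  Trail⇒GoodPath : (P : Trail s x p q) → Distinct P → GoodPath E (length P)
  Trail⇒GoodPath {s = s} {x = x} P dP = loose , inj-end (vertex-zero P) , vertex-last P , degree-one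
    where
    loose : LoosePath E (length P)
    loose = record
      { seq      = vertex P
      ; distinct = vertex-injective P dP
      ; edges    = vertex-edge P }
    inj-end : ∀ {v} → v ≡ outer s x → InV₁∪V₃ v
    inj-end refl = outer∈V₁∪V₃ s x
    degree-one : ∀ j → j ≤ 2 * length P → j ≢ 0 → j ≢ 2 * length P →
                 pathDeg (length P) j ≡ 1 → InV₂ (vertex P j)
    degree-one j j≤ j≢0 j≢end deg≡1 with vertex-even-or-V₂ P j j≤
    ... | inj₂ V₂ = V₂
    ... | inj₁ (i , refl) =
      contradiction (≤-trans (pathDeg-interior-even 0<i i<ℓ) (≤-reflexive deg≡1)) λ { (s≤s ()) }
      where
      0<i : 0 < i
      0<i = n≢0⇒n>0 λ { refl → j≢0 refl }
      i<ℓ : i < length P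
      i<ℓ = ≤∧≢⇒< (*-cancelˡ-≤ 2 j≤) λ { refl → j≢end refl }

  AllVertices-zip : ∀ {Q R : Vtx t → Set} (P : Trail s x p q) →
                    AllVertices Q P → AllVertices R P → AllVertices (λ v → Q v × R v) P
  AllVertices-zip (start _ _)        Qv             Rv             = Qv , Rv
  AllVertices-zip (extend P _ _ _ _) (QP , Qc , Qy) (RP , Rc , Ry) =
    AllVertices-zip P QP RP , (Qc , Rc) , (Qy , Ry)

  AllVertices-end : ∀ {Q} (P : Trail s x p q) → AllVertices Q P → Q (outer s x)
  AllVertices-end (start _ _)        Qv           = Qv
  AllVertices-end (extend _ _ _ _ _) (_ , _ , Qy) = Qy

corners : ∀ {t} {E : Tripartite3Graph t} {X₁ X₂ X₃} → HasEdgeIn E X₁ X₂ X₃ → Fin t × Fin (2 * t) × Fin t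
corners (a , b , c , _) = a , b , c

module Certified {t k : ℕ} {E : Tripartite3Graph t}
  (dense : (X₁ : Subset t) (X₂ : Subset (2 * t)) (X₃ : Subset t) →
           ∣ X₁ ∣ ≡ k → ∣ X₂ ∣ ≡ k → ∣ X₃ ∣ ≡ k → HasEdgeIn E X₁ X₂ X₃) where

  -- E need not be decidable, so the search only follows the edges that `dense` exhibits:
  -- they are finitely many, decidable, and still meet every triple of k-sets.
  Certified : Fin t → Fin (2 * t) → Fin t → Set
  Certified a b c =
    Σ (Subset t) λ X₁ → Σ (Subset (2 * t)) λ X₂ → Σ (Subset t) λ X₃ →
    Σ (∣ X₁ ∣ ≡ k) λ k₁ → Σ (∣ X₂ ∣ ≡ k) λ k₂ → Σ (∣ X₃ ∣ ≡ k) λ k₃ →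
    corners (dense X₁ X₂ X₃ k₁ k₂ k₃) ≡ (a , b , c)

  certified? : ∀ a b c → Dec (Certified a b c)
  certified? a b c =
    anySubset? λ X₁ → anySubset? λ X₂ → anySubset? λ X₃ →
    Σ-≡? λ k₁ → Σ-≡? λ k₂ → Σ-≡? λ k₃ →
    ≡-dec Fin._≟_ (≡-dec Fin._≟_ Fin._≟_) (corners (dense X₁ X₂ X₃ k₁ k₂ k₃)) (a , b , c)

  certified⇒edge : ∀ {a b c} → Certified a b c → E a b c
  certified⇒edge (X₁ , X₂ , X₃ , k₁ , k₂ , k₃ , eq) with dense X₁ X₂ X₃ k₁ k₂ k₃ | eq
  ... | _ , _ , _ , _ , _ , _ , e | refl = e

  certified-inside : ∀ X₁ X₂ X₃ → ∣ X₁ ∣ ≡ k → ∣ X₂ ∣ ≡ k → ∣ X₃ ∣ ≡ k →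
                     ∃ λ a → ∃ λ b → ∃ λ c → a ∈ X₁ × b ∈ X₂ × c ∈ X₃ × Certified a b c
  certified-inside X₁ X₂ X₃ k₁ k₂ k₃ with dense X₁ X₂ X₃ k₁ k₂ k₃ in eq
  ... | a , b , c , a∈ , b∈ , c∈ , _ = a , b , c , a∈ , b∈ , c∈ , X₁ , X₂ , X₃ , k₁ , k₂ , k₃ , cong corners eq

  Arc : Side → Fin t → Fin (2 * t) → Fin t → Set
  Arc first x c y = Certified x c y
  Arc third x c y = Certified y c x

  arc⇒edge : ∀ {s s' x c y} → Opposite s s' → Arc s x c y → IsEdge E (outer s x) (v₂ c) (outer s' y)
  arc⇒edge first-third arc = _ , _ , _ , certified⇒edge arc , σ123
  arc⇒edge third-first arc = _ , _ , _ , certified⇒edge arc , σ321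

  Link : Side → Fin t → Subset (2 * t) → Subset t → Set
  Link s x B T = ∃ λ c → ∃ λ y → c ∈ B × y ∈ T × Arc s x c y

  link? : ∀ s x B T → Dec (Link s x B T)
  link? s x B T = Fin.any? λ c → Fin.any? λ y → (c ∈? B) ×-dec (y ∈? T) ×-dec arc? s c y
    where
    arc? : ∀ s c y → Dec (Arc s x c y)
    arc? first c y = certified? x c y
    arc? third c y = certified? y c x

  Link-mono : ∀ {s x B B′ T T′} → B ⊆ B′ → T ⊆ T′ → Link s x B T → Link s x B′ T′
  Link-mono B⊆ T⊆ (c , y , c∈ , y∈ , arc) = c , y , B⊆ c∈ , T⊆ y∈ , arc

  dense-link : ∀ s {S B T} → k ≤ ∣ S ∣ → k ≤ ∣ B ∣ → k ≤ ∣ T ∣ → ∃ λ x → x ∈ S × Link s x B T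
  dense-link s {S} {B} {T} k≤S k≤B k≤T
    with subset-of-size k S k≤S | subset-of-size k B k≤B | subset-of-size k T k≤T
  ... | S′ , S′⊆ , ∣S′∣ | B′ , B′⊆ , ∣B′∣ | T′ , T′⊆ , ∣T′∣ = link s
    where
    link : ∀ s → ∃ λ x → x ∈ S × Link s x B T
    link first with certified-inside S′ B′ T′ ∣S′∣ ∣B′∣ ∣T′∣
    ... | a , b , c , a∈ , b∈ , c∈ , cert = a , S′⊆ a∈ , b , c , B′⊆ b∈ , T′⊆ c∈ , cert
    link third with certified-inside T′ B′ S′ ∣T′∣ ∣B′∣ ∣S′∣
    ... | a , b , c , a∈ , b∈ , c∈ , cert = c , S′⊆ c∈ , b , a , B′⊆ b∈ , T′⊆ a∈ , cert

module Search {t k : ℕ} {E : Tripartite3Graph t}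
  (dense : (X₁ : Subset t) (X₂ : Subset (2 * t)) (X₃ : Subset t) →
           ∣ X₁ ∣ ≡ k → ∣ X₂ ∣ ≡ k → ∣ X₃ ∣ ≡ k → HasEdgeIn E X₁ X₂ X₃)
  (room : 4 * k ≤ 2 * t) (k>0 : 0 < k) where

  open Certified dense
  open Trails E

  ℓ : ℕ
  ℓ = 2 * t ∸ 4 * k

  record Pool : Set where
    field
      fresh dead : Subset t
      fresh∉dead : ∀ {x} → x ∈ fresh → x ∉ dead
      few-dead   : ∣ dead ∣ < k
  open Pool

  take : Fin t → Pool → Pool
  take y π = record π { fresh = fresh π - y ; fresh∉dead = fresh∉dead π ∘ p─q⊆p (fresh π) ⁅ y ⁆ }

  fresh-take⊆ : ∀ y π → fresh (take y π) ⊆ fresh π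
  fresh-take⊆ y π = p─q⊆p (fresh π) ⁅ y ⁆

  bury : (x : Fin t) (π : Pool) → x ∉ fresh π → x ∉ dead π → suc ∣ dead π ∣ < k → Pool
  bury x π x∉fresh x∉dead room-left = record
    { fresh      = fresh π
    ; dead       = dead π ∪ ⁅ x ⁆
    ; fresh∉dead = fresh∉dead′
    ; few-dead   = subst (_< k) (sym (∣p∪⁅x⁆∣≡1+∣p∣ x∉dead)) room-left }
    where
    fresh∉dead′ : ∀ {z} → z ∈ fresh π → z ∉ dead π ∪ ⁅ x ⁆
    fresh∉dead′ z∈fresh z∈dead′ with x∈p∪q⁻ (dead π) ⁅ x ⁆ z∈dead′
    ... | inj₁ z∈dead = fresh∉dead π z∈fresh z∈dead
    ... | inj₂ z∈⁅x⁆  = x∉fresh (subst (_∈ fresh π) (x∈⁅y⁆⇒x≡y x z∈⁅x⁆) z∈fresh)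

  record Spent (s : Side) (π : Pool) (v : Vtx t) : Set where
    constructor spent
    field avoids : ∀ x → v ≡ outer s x → x ∉ fresh π × x ∉ dead π
  open Spent

  record SpentMid (B : Subset (2 * t)) (v : Vtx t) : Set where
    constructor spent₂
    field avoids₂ : ∀ c → v ≡ v₂ c → c ∉ B
  open SpentMid

  Spent-take : ∀ {s π v} y → Spent s π v → Spent s (take y π) v
  Spent-take {π = π} y (spent sp) = spent λ x v≡ → proj₁ (sp x v≡) ∘ fresh-take⊆ y π , proj₂ (sp x v≡)

  Spent-taken : ∀ {s} π {y} → y ∈ fresh π → Spent s (take y π) (outer s y)
  Spent-taken {s} π {y} y∈ = spent λ x y≡x →
    subst (λ z → z ∉ fresh π - y × z ∉ dead π) (outer-injective {s = s} y≡x) (x∉p-x y (fresh π) , fresh∉dead π y∈)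

  Spent-opposite : ∀ {s s' π} y → Opposite s s' → Spent s' π (outer s y)
  Spent-opposite y opp = spent λ x e → contradiction e (outer-opposite opp)

  Spent-v₂ : ∀ {s π} c → Spent s π (v₂ c)
  Spent-v₂ {s} c = spent λ x e → contradiction (sym e) (outer≢v₂ {s = s})

  SpentMid-outer : ∀ {B} s y → SpentMid B (outer s y)
  SpentMid-outer s y = spent₂ λ c e → contradiction e (outer≢v₂ {s = s})

  SpentMid-remove : ∀ {B v} c → SpentMid B v → SpentMid (B - c) v
  SpentMid-remove {B} c (spent₂ sp) = spent₂ λ c′ e → sp c′ e ∘ p─q⊆p B ⁅ c ⁆

  SpentMid-removed : ∀ {B} c → SpentMid (B - c) (v₂ c)
  SpentMid-removed {B} c = spent₂ λ { c′ refl → x∉p-x c B }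

  private variable
    a b : Side
    x : Fin t
    p q : ℕ

  -- ᵃ refers to the part of the end of the current trail, ᵇ to the opposite part.
  record Stock (a b : Side) (p q : ℕ) : Set where
    field
      opposite    : Opposite a b
      poolᵃ poolᵇ : Pool
      mids        : Subset (2 * t)
      countᵃ      : ∣ fresh poolᵃ ∣ + ∣ dead poolᵃ ∣ + p ≡ t
      countᵇ      : ∣ fresh poolᵇ ∣ + ∣ dead poolᵇ ∣ + q ≡ t
      enough-mids : ∣ fresh poolᵃ ∣ + ∣ fresh poolᵇ ∣ ≤ ∣ mids ∣
      stuckᵃ      : ∀ {x} → x ∈ dead poolᵃ → ¬ Link a x mids (fresh poolᵇ)
      stuckᵇ      : ∀ {x} → x ∈ dead poolᵇ → ¬ Link b x mids (fresh poolᵃ)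
  open Stock

  Used : Stock a b p q → Vtx t → Set
  Used {a} {b} σ v = Spent a (poolᵃ σ) v × Spent b (poolᵇ σ) v × SpentMid (mids σ) v

  data State : Set where
    idle  : Stock a b 0 0 → State
    along : (σ : Stock a b p q) (P : Trail a x p q) →
            Distinct P → length P < ℓ → AllVertices (Used σ) P → State

  weight : Stock a b p q → ℕ
  weight {p = p} {q} σ = 2 * (∣ fresh (poolᵃ σ) ∣ + ∣ fresh (poolᵇ σ) ∣) + (p + q)

  μ : State → ℕ
  μ (idle σ)          = weight σ
  μ (along σ _ _ _ _) = weight σ

  Progress : ℕ → Set
  Progress w = GoodPath E ℓ ⊎ ∃ λ st → μ st < w

  proceed : ∀ {w} (σ : Stock a b p q) (P : Trail a x p q) → Distinct P → length P ≤ ℓ →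
            AllVertices (Used σ) P → weight σ < w → Progress w
  proceed σ P d len≤ℓ used lighter with length P <? ℓ
  ... | yes len<ℓ = inj₂ (along σ P d len<ℓ used , lighter)
  ... | no  len≮ℓ = inj₁ (subst (GoodPath E) (≤∧≮⇒≡ len≤ℓ len≮ℓ) (Trail⇒GoodPath P d))

  count-take : ∀ {T : Subset t} {S q y} → y ∈ T → ∣ T ∣ + S + q ≡ t → ∣ T - y ∣ + S + suc q ≡ t
  count-take {T} {S} {q} {y} y∈T count = begin
    ∣ T - y ∣ + S + suc q  ≡⟨ +-suc (∣ T - y ∣ + S) q ⟩
    suc ∣ T - y ∣ + S + q  ≡⟨ cong (λ n → n + S + q) (∣p∣≡1+∣p-x∣ y∈T) ⟨
    ∣ T ∣ + S + q          ≡⟨ count ⟩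
    t                      ∎
    where open ≡-Reasoning

  k≤t : k ≤ t
  k≤t = ≤-trans (m≤m+n k (k + 0)) (*-cancelˡ-≤ 2 (subst (_≤ 2 * t) (*-assoc 2 2 k) room))

  begin-trail : (σ : Stock a b 0 0) → Progress (weight σ)
  begin-trail {a} {b} σ with ∣p∣>0⇒nonempty (fresh (poolᵃ σ)) fresh-left
    where
    fresh-left : 0 < ∣ fresh (poolᵃ σ) ∣
    fresh-left = m+n+0≡o⇒n<o⇒0<m (countᵃ σ) (<-≤-trans (few-dead (poolᵃ σ)) k≤t)
  ... | y , y∈ = proceed σ′ (start a y) tt z≤n used (≤-reflexive (sym lighter))
    where
    σ′ : Stock a b 1 0
    σ′ = record
      { opposite    = opposite σ
      ; poolᵃ       = take y (poolᵃ σ)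
      ; poolᵇ       = poolᵇ σ
      ; mids        = mids σ
      ; countᵃ      = count-take y∈ (countᵃ σ)
      ; countᵇ      = countᵇ σ
      ; enough-mids = ≤-trans (+-monoˡ-≤ _ (p⊆q⇒∣p∣≤∣q∣ (fresh-take⊆ y (poolᵃ σ)))) (enough-mids σ)
      ; stuckᵃ      = stuckᵃ σ
      ; stuckᵇ      = λ x∈ → stuckᵇ σ x∈ ∘ Link-mono (λ c∈ → c∈) (fresh-take⊆ y (poolᵃ σ)) }
    used : Used σ′ (outer a y)
    used = Spent-taken (poolᵃ σ) y∈ , Spent-opposite y (opposite σ) , SpentMid-outer a y
    lighter : weight σ ≡ suc (weight σ′)
    lighter = begin
      2 * (∣ fresh (poolᵃ σ) ∣ + B) + 0       ≡⟨ cong (λ n → 2 * (n + B) + 0) (∣p∣≡1+∣p-x∣ y∈) ⟩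
      2 * (suc ∣ fresh (poolᵃ σ′) ∣ + B) + 0  ≡⟨ regroup ∣ fresh (poolᵃ σ′) ∣ B ⟩
      suc (weight σ′)                         ∎
      where
      open ≡-Reasoning
      B = ∣ fresh (poolᵇ σ) ∣
      regroup : ∀ A B → 2 * (suc A + B) + 0 ≡ suc (2 * (A + B) + 1)
      regroup = solve-∀

  advance : (σ : Stock a b p q) (P : Trail a x p q) → Distinct P → length P < ℓ →
            AllVertices (Used σ) P → Link a x (mids σ) (fresh (poolᵇ σ)) → Progress (weight σ)
  advance {a} {b} {p} {q} σ P d short used (c , y , c∈ , y∈ , arc) =
    proceed σ′ P′ d′ short used′ (≤-reflexive (sym lighter))
    where
    A = ∣ fresh (poolᵃ σ) ∣
    r = ∣ fresh (poolᵇ σ) - y ∣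
    P′ : Trail b y (suc q) p
    P′ = extend P (opposite σ) c y (arc⇒edge (opposite σ) arc)
    enough : suc (r + A) ≤ suc ∣ mids σ - c ∣
    enough = begin
      suc (r + A)              ≡⟨ cong suc (+-comm r A) ⟩
      suc (A + r)              ≡⟨ +-suc A r ⟨
      A + suc r                ≡⟨ cong (A +_) (∣p∣≡1+∣p-x∣ y∈) ⟨
      A + ∣ fresh (poolᵇ σ) ∣  ≤⟨ enough-mids σ ⟩
      ∣ mids σ ∣               ≡⟨ ∣p∣≡1+∣p-x∣ c∈ ⟩
      suc ∣ mids σ - c ∣       ∎
      where open ≤-Reasoning
    σ′ : Stock b a (suc q) p
    σ′ = record
      { opposite    = Opposite-sym (opposite σ)
      ; poolᵃ       = take y (poolᵇ σ)
      ; poolᵇ       = poolᵃ σ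
      ; mids        = mids σ - c
      ; countᵃ      = count-take y∈ (countᵇ σ)
      ; countᵇ      = countᵃ σ
      ; enough-mids = ≤-pred enough
      ; stuckᵃ      = λ x∈ → stuckᵇ σ x∈ ∘ Link-mono (p─q⊆p (mids σ) ⁅ c ⁆) (λ z∈ → z∈)
      ; stuckᵇ      = λ x∈ → stuckᵃ σ x∈ ∘ Link-mono (p─q⊆p (mids σ) ⁅ c ⁆) (fresh-take⊆ y (poolᵇ σ)) }
    d′ : Distinct P′
    d′ = d , AllVertices-map (λ (_ , _ , mid) e → avoids₂ mid c e c∈) P used
           , AllVertices-map (λ (_ , spentᵇ , _) e → proj₁ (avoids spentᵇ y e) y∈) P used
    used′ : AllVertices (Used σ′) P′
    used′ = AllVertices-map (λ (spentᵃ , spentᵇ , mid) → Spent-take y spentᵇ , spentᵃ , SpentMid-remove c mid) P used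
          , (Spent-v₂ c , Spent-v₂ c , SpentMid-removed c)
          , (Spent-taken (poolᵇ σ) y∈ , Spent-opposite y (Opposite-sym (opposite σ)) , SpentMid-outer b y)
    lighter : weight σ ≡ suc (weight σ′)
    lighter = begin
      2 * (A + ∣ fresh (poolᵇ σ) ∣) + (p + q)  ≡⟨ cong (λ n → 2 * (A + n) + (p + q)) (∣p∣≡1+∣p-x∣ y∈) ⟩
      2 * (A + suc r) + (p + q)                ≡⟨ regroup A r p q ⟩
      suc (weight σ′)                          ∎
      where
      open ≡-Reasoning
      regroup : ∀ A r p q → 2 * (A + suc r) + (p + q) ≡ suc (2 * (r + A) + (suc q + p))
      regroup = solve-∀

  many-fresh : (σ : Stock a b p q) (P : Trail a x p q) → length P < ℓ → k ≤ ∣ fresh (poolᵇ σ) ∣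
  many-fresh {q = q} σ P short =
    counting-bound count (few-dead (poolᵇ σ))
      (+-monoˡ-≤ q (proj₁ (counts-balanced P))) (≤-trans (≤-reflexive (counts-length P)) short)
    where
    count : 2 * (∣ fresh (poolᵇ σ) ∣ + ∣ dead (poolᵇ σ) ∣ + q) ≡ ℓ + 4 * k
    count = trans (cong (2 *_) (countᵇ σ)) (sym (m∸n+n≡m room))

  count-bury : ∀ {T} {S : Subset t} {x p} → x ∉ S → T + ∣ S ∣ + suc p ≡ t → T + ∣ S ∪ ⁅ x ⁆ ∣ + p ≡ t
  count-bury {T} {S = S} {x} {p} x∉S count = begin
    T + ∣ S ∪ ⁅ x ⁆ ∣ + p  ≡⟨ cong (λ n → T + n + p) (∣p∪⁅x⁆∣≡1+∣p∣ x∉S) ⟩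
    T + suc ∣ S ∣ + p      ≡⟨ cong (_+ p) (+-suc T ∣ S ∣) ⟩
    suc (T + ∣ S ∣ + p)    ≡⟨ +-suc (T + ∣ S ∣) p ⟨
    T + ∣ S ∣ + suc p      ≡⟨ count ⟩
    t                      ∎
    where open ≡-Reasoning

  stuck-or-end : (σ : Stock a b p q) → ¬ Link a x (mids σ) (fresh (poolᵇ σ)) →
                 ∀ {z} → z ∈ dead (poolᵃ σ) ∪ ⁅ x ⁆ → ¬ Link a z (mids σ) (fresh (poolᵇ σ))
  stuck-or-end {x = x} σ ¬link z∈ with x∈p∪q⁻ (dead (poolᵃ σ)) ⁅ x ⁆ z∈
  ... | inj₁ z∈dead = stuckᵃ σ z∈dead
  ... | inj₂ z∈⁅x⁆ rewrite x∈⁅y⁆⇒x≡y x z∈⁅x⁆ = ¬link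

  module _ (σ : Stock a b (suc p) q) (x : Fin t) (end : Spent a (poolᵃ σ) (outer a x))
           (room-left : suc ∣ dead (poolᵃ σ) ∣ < k) (¬link : ¬ Link a x (mids σ) (fresh (poolᵇ σ))) where

    x∉fresh : x ∉ fresh (poolᵃ σ)
    x∉fresh = proj₁ (avoids end x refl)

    x∉dead : x ∉ dead (poolᵃ σ)
    x∉dead = proj₂ (avoids end x refl)

    abandon : Stock b a q p
    abandon = record
      { opposite    = Opposite-sym (opposite σ)
      ; poolᵃ       = poolᵇ σ
      ; poolᵇ       = bury x (poolᵃ σ) x∉fresh x∉dead room-left
      ; mids        = mids σ
      ; countᵃ      = countᵇ σ
      ; countᵇ      = count-bury x∉dead (countᵃ σ)
      ; enough-mids = subst (_≤ ∣ mids σ ∣) (+-comm ∣ fresh (poolᵃ σ) ∣ ∣ fresh (poolᵇ σ) ∣) (enough-mids σ)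
      ; stuckᵃ      = stuckᵇ σ
      ; stuckᵇ      = stuck-or-end σ ¬link }

    abandon-keeps : ∀ {v} → Used σ v × v ≢ outer a x → Used abandon v
    abandon-keeps {v} ((spentᵃ , spentᵇ , mid) , v≢x) = spentᵇ , spent buried , mid
      where
      buried : ∀ z → v ≡ outer a z → z ∉ fresh (poolᵃ σ) × z ∉ dead (poolᵃ σ) ∪ ⁅ x ⁆
      buried z refl = proj₁ (avoids spentᵃ z refl) , λ z∈ →
        [ proj₂ (avoids spentᵃ z refl) , (λ z∈⁅x⁆ → v≢x (cong (outer a) (x∈⁅y⁆⇒x≡y x z∈⁅x⁆))) ]′
        (x∈p∪q⁻ (dead (poolᵃ σ)) ⁅ x ⁆ z∈)

    abandon-lighter : weight abandon < weight σ
    abandon-lighter = ≤-reflexive (regroup ∣ fresh (poolᵃ σ) ∣ ∣ fresh (poolᵇ σ) ∣ p q)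
      where
      regroup : ∀ A B p q → suc (2 * (B + A) + (q + p)) ≡ 2 * (A + B) + (suc p + q)
      regroup = solve-∀

  back-off : (σ : Stock a b p q) (P : Trail a x p q) → Distinct P → length P < ℓ → AllVertices (Used σ) P →
             suc ∣ dead (poolᵃ σ) ∣ < k → ¬ Link a x (mids σ) (fresh (poolᵇ σ)) → ∃ λ st → μ st < weight σ
  back-off σ (start _ x) _ _ (end , _) room-left ¬link =
    idle (abandon σ x end room-left ¬link) , abandon-lighter σ x end room-left ¬link
  back-off σ (extend P o _ x _) (d , _ , x∉P) short (used , _ , (end , _)) room-left ¬link
    with opposite-unique o (opposite σ)
  ... | refl = along (abandon σ x end room-left ¬link) P d (<-trans (n<1+n _) short)
                     (AllVertices-map (abandon-keeps σ x end room-left ¬link) P (AllVertices-zip P used x∉P))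
             , abandon-lighter σ x end room-left ¬link

  -- Otherwise dead (poolᵃ σ) ∪ ⁅ x ⁆, mids σ and fresh (poolᵇ σ) all have k elements.
  dead-room : (σ : Stock a b p q) (P : Trail a x p q) → length P < ℓ → AllVertices (Used σ) P →
              ¬ Link a x (mids σ) (fresh (poolᵇ σ)) → suc ∣ dead (poolᵃ σ) ∣ < k
  dead-room {a} {x = x} σ P short used ¬link = ≰⇒> λ k≤dead′ →
    let z , z∈ , link = dense-link a (subst (k ≤_) (sym (∣p∪⁅x⁆∣≡1+∣p∣ x∉deadᵃ)) k≤dead′) k≤mids k≤fresh
    in  stuck-or-end σ ¬link z∈ link
    where
    x∉deadᵃ : x ∉ dead (poolᵃ σ)
    x∉deadᵃ = proj₂ (avoids (proj₁ (AllVertices-end P used)) x refl)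
    k≤fresh : k ≤ ∣ fresh (poolᵇ σ) ∣
    k≤fresh = many-fresh σ P short
    k≤mids : k ≤ ∣ mids σ ∣
    k≤mids = ≤-trans k≤fresh (≤-trans (m≤n+m _ _) (enough-mids σ))

  retreat : (σ : Stock a b p q) (P : Trail a x p q) → Distinct P → length P < ℓ →
            AllVertices (Used σ) P → ¬ Link a x (mids σ) (fresh (poolᵇ σ)) → Progress (weight σ)
  retreat σ P d short used ¬link = inj₂ (back-off σ P d short used (dead-room σ P short used ¬link) ¬link)


  step : ∀ st → Progress (μ st)
  step (idle σ) = begin-trail σ
  step (along {a = a} {x = x} σ P d short used) with link? a x (mids σ) (fresh (poolᵇ σ))
  ... | yes link = advance σ P d short used link
  ... | no ¬link = retreat σ P d short used ¬link

  search : ∀ n st → μ st < n → GoodPath E ℓ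
  search (suc n) st μ<n with step st
  ... | inj₁ path              = path
  ... | inj₂ (st′ , μ′<μ)      = search n st′ (≤-trans μ′<μ (≤-pred μ<n))

  initial : Stock first third 0 0
  initial = record
    { opposite    = first-third
    ; poolᵃ       = everything
    ; poolᵇ       = everything
    ; mids        = Subset.⊤
    ; countᵃ      = full
    ; countᵇ      = full
    ; enough-mids = ≤-reflexive (trans (cong₂ _+_ (∣⊤∣≡n t) (∣⊤∣≡n t))
                                       (sym (trans (∣⊤∣≡n (2 * t)) (cong (t +_) (+-identityʳ t)))))
    ; stuckᵃ      = λ x∈⊥ → contradiction x∈⊥ ∉⊥
    ; stuckᵇ      = λ x∈⊥ → contradiction x∈⊥ ∉⊥ }
    where
    everything : Pool
    everything = record
      { fresh      = Subset.⊤
      ; dead       = Subset.⊥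
      ; fresh∉dead = λ _ → ∉⊥
      ; few-dead   = subst (_< k) (sym (∣⊥∣≡0 t)) k>0 }
    full : ∣ Subset.⊤ {t} ∣ + ∣ Subset.⊥ {t} ∣ + 0 ≡ t
    full = trans (+-identityʳ _) (trans (cong₂ _+_ (∣⊤∣≡n t) (∣⊥∣≡0 t)) (+-identityʳ t))

  good-path : GoodPath E ℓ
  good-path = search _ (idle initial) ≤-refl

lemma4p2 : (t k : ℕ) (E : Tripartite3Graph t) → 4 * k ≤ 2 * t →
    ((X₁ : Subset t) (X₂ : Subset (2 * t)) (X₃ : Subset t) →
      ∣ X₁ ∣ ≡ k → ∣ X₂ ∣ ≡ k → ∣ X₃ ∣ ≡ k → HasEdgeIn E X₁ X₂ X₃) →
    GoodPath E (2 * t ∸ 4 * k)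
lemma4p2 t zero    E room dense with dense Subset.⊥ Subset.⊥ Subset.⊥ (∣⊥∣≡0 t) (∣⊥∣≡0 (2 * t)) (∣⊥∣≡0 t)
... | _ , _ , _ , a∈⊥ , _ = contradiction a∈⊥ ∉⊥
lemma4p2 t (suc k) E room dense = Search.good-path dense room z<s
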